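{- Let $G_1, G_2$ be two graphs on the same vertex set $V$. Let $A \subseteq S(G_2)$ and $B \subseteq V$ be such that $N_{G_1}(B) \cup N_{G_2}(B) \subseteq A$. Suppose that $E(G_1) \triangle E(G_2) \subseteq \binom{A \cup B}{2}$. Then $S(G_1) \setminus B \subseteq S(G_2) \setminus B$.
   Context: All graphs are finite and simple; $\triangle$ denotes symmetric difference. For a graph $G$ and $X \subseteq V(G)$, $N_G(X) \coloneqq \{y \in V(G)\setminus X \colon y \text{ has a neighbour in } X\}$ and $N_G(x) \coloneqq N_G(\{x\})$. A set $X \subseteq V(G)$ has the strong $4$-core property for $G$ if $|N_G(x) \cap X| \geq 4$ for every $x \in X \cup N_G(X)$; the strong $4$-core $S(G)$ is the largest set with this property (the union of all such sets, which again has the property). -}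

module Defs where

open import Data.Nat using (ℕ; _≤_)
open import Data.Bool using (Bool; true; false)
open import Data.Fin using (Fin)
open import Data.Fin.Subset using (Subset; _∈_; _∉_; _∩_; ∣_∣)
open import Data.Vec using (tabulate)
open import Data.Product using (Σ; ∃; _×_)
open import Data.Sum using (_⊎_)
open import Relation.Nullary using (¬_)
open import Relation.Binary.PropositionalEquality using (_≡_)

record Graph (n : ℕ) : Set where
  field
    adj   : Fin n → Fin n → Bool
    sym   : ∀ x y → adj x y ≡ adj y x
    irrefl : ∀ x → adj x x ≡ false
open Graph public

Adj : ∀ {n} → Graph n → Fin n → Fin n → Set
Adj G x y = adj G x y ≡ true

nbhd : ∀ {n} → Graph n → Fin n → Subset n
nbhd G x = tabulate (λ y → adj G x y)

InN : ∀ {n} → Graph n → Subset n → Fin n → Set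
InN G X y = y ∉ X × ∃ (λ x → x ∈ X × Adj G x y)

Strong4 : ∀ {n} → Graph n → Subset n → Set
Strong4 G X = ∀ x → (x ∈ X ⊎ InN G X x) → 4 ≤ ∣ nbhd G x ∩ X ∣

-- x ∈ S(G): S(G) is the union of all sets with the strong 4-core property
InS : ∀ {n} → Graph n → Fin n → Set
InS G x = ∃ (λ X → Strong4 G X × x ∈ X)

{-# OPTIONS --safe #-}
-- Take a strong 4-core set X of G₁ containing x, and a strong 4-core set U of G₂ containing A
-- (a finite union of the witnesses for A ⊆ S(G₂)). Then (X ∖ B) ∪ U is a strong 4-core set
-- of G₂: a vertex of its closed neighbourhood that is not already covered by U lies outside
-- A ∪ B, so its G₁- and G₂-edges coincide, and its neighbours in X avoid B (as N(B) ⊆ A).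
module Submission where

open import Defs
open import Data.Nat using (ℕ; _≤_)
open import Data.Nat.Properties using (≤-trans)
open import Data.Bool using (true)
import Data.Bool.Properties as Bool
open import Data.Fin using (Fin)
open import Data.Fin.Properties using (any?)
open import Data.Fin.Subset using (Subset; _∈_; _∉_; _∩_; _∪_; ∁; ⊥; _⊆_; ∣_∣)
open import Data.Fin.Subset.Properties
open import Data.List using (List; []; _∷_; filter; allFin)
open import Data.List.Relation.Unary.All as All using (All; []; _∷_)
open import Data.List.Membership.Propositional.Properties using (∈-allFin; ∈-filter⁺; ∈-filter⁻)
open import Data.Vec.Properties using (lookup∘tabulate; []=⇒lookup; tabulate-cong)
open import Data.Product using (_×_; _,_; ∃; proj₁; proj₂)
open import Data.Sum using (_⊎_; inj₁; inj₂; [_,_])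
open import Data.Empty using (⊥-elim)
open import Function using (id; _∘_)
open import Relation.Nullary using (Dec; yes; no; ¬_)
open import Relation.Nullary.Decidable using (_×-dec_)
open import Relation.Binary.PropositionalEquality
  using (_≡_; _≢_; trans; subst; module ≡-Reasoning)
  renaming (sym to ≡-sym)

private
  variable
    n : ℕ

Adj-sym : (G : Graph n) {x y : Fin n} → Adj G x y → Adj G y x
Adj-sym G {x} {y} = trans (sym G y x)

∈nbhd⇒Adj : (G : Graph n) {x y : Fin n} → y ∈ nbhd G x → Adj G x y
∈nbhd⇒Adj G {x} {y} y∈ = trans (≡-sym (lookup∘tabulate (adj G x) y)) ([]=⇒lookup y∈)

x∈p∩∁q⇒x∉q : (p : Subset n) {q : Subset n} {x : Fin n} → x ∈ p ∩ ∁ q → x ∉ q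
x∈p∩∁q⇒x∉q p {q} x∈ = x∈∁p⇒x∉p (proj₂ (x∈p∩q⁻ p (∁ q) x∈))

∣∩∣-monoʳ : (p : Subset n) {X Y : Subset n} → X ⊆ Y → ∣ p ∩ X ∣ ≤ ∣ p ∩ Y ∣
∣∩∣-monoʳ p {X} X⊆Y = p⊆q⇒∣p∣≤∣q∣ λ w∈ → let w∈p , w∈X = x∈p∩q⁻ p X w∈ in x∈p∩q⁺ (w∈p , X⊆Y w∈X)

nbhd-cong : (G₁ G₂ : Graph n) {y : Fin n} → (∀ w → adj G₁ y w ≡ adj G₂ y w) → nbhd G₁ y ≡ nbhd G₂ y
nbhd-cong G₁ G₂ = tabulate-cong

InClosedN : Graph n → Subset n → Fin n → Set
InClosedN G X y = y ∈ X ⊎ InN G X y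

inClosedN? : (G : Graph n) (X : Subset n) (y : Fin n) → Dec (InClosedN G X y)
inClosedN? G X y with y ∈? X
... | yes y∈X = yes (inj₁ y∈X)
... | no y∉X with any? (λ w → (w ∈? X) ×-dec (adj G w y Bool.≟ true))
...   | yes (w , w∈X , e) = yes (inj₂ (y∉X , w , w∈X , e))
...   | no ¬nb = no [ y∉X , (λ (_ , nb) → ¬nb nb) ]

InClosedN-mono : (G : Graph n) {X Y : Subset n} {y : Fin n} → X ⊆ Y → InClosedN G X y → InClosedN G Y y
InClosedN-mono G X⊆Y (inj₁ y∈X) = inj₁ (X⊆Y y∈X)
InClosedN-mono G {Y = Y} {y} X⊆Y (inj₂ (_ , w , w∈X , e)) with y ∈? Y
... | yes y∈Y = inj₁ y∈Y
... | no y∉Y = inj₂ (y∉Y , w , X⊆Y w∈X , e)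

InClosedN-∪⁻ : (G : Graph n) (X Y : Subset n) {y : Fin n} →
               InClosedN G (X ∪ Y) y → InClosedN G X y ⊎ InClosedN G Y y
InClosedN-∪⁻ G X Y (inj₁ y∈X∪Y) with x∈p∪q⁻ X Y y∈X∪Y
... | inj₁ y∈X = inj₁ (inj₁ y∈X)
... | inj₂ y∈Y = inj₂ (inj₁ y∈Y)
InClosedN-∪⁻ G X Y (inj₂ (y∉X∪Y , w , w∈X∪Y , e)) with x∈p∪q⁻ X Y w∈X∪Y
... | inj₁ w∈X = inj₁ (inj₂ (y∉X∪Y ∘ p⊆p∪q Y , w , w∈X , e))
... | inj₂ w∈Y = inj₂ (inj₂ (y∉X∪Y ∘ q⊆p∪q X Y , w , w∈Y , e))

InClosedN-agree : (G₁ G₂ : Graph n) {X : Subset n} {y : Fin n} → (∀ w → adj G₁ y w ≡ adj G₂ y w) →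
                  InClosedN G₂ X y → InClosedN G₁ X y
InClosedN-agree G₁ G₂ agree (inj₁ y∈X) = inj₁ y∈X
InClosedN-agree G₁ G₂ {y = y} agree (inj₂ (y∉X , w , w∈X , e)) = inj₂ (y∉X , w , w∈X , e₁)
  where
  open ≡-Reasoning
  e₁ : Adj G₁ w y
  e₁ = begin
    adj G₁ w y ≡⟨ sym G₁ w y ⟩
    adj G₁ y w ≡⟨ agree w ⟩
    adj G₂ y w ≡⟨ Adj-sym G₂ e ⟩
    true       ∎

Strong4-weaken : (G : Graph n) {X Y : Subset n} → Strong4 G X → X ⊆ Y →
                 ∀ y → InClosedN G X y → 4 ≤ ∣ nbhd G y ∩ Y ∣
Strong4-weaken G sX X⊆Y y y∈N[X] = ≤-trans (sX y y∈N[X]) (∣∩∣-monoʳ (nbhd G y) X⊆Y)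

Strong4-⊥ : (G : Graph n) → Strong4 G ⊥
Strong4-⊥ G x (inj₁ x∈⊥) = ⊥-elim (∉⊥ x∈⊥)
Strong4-⊥ G x (inj₂ (_ , _ , w∈⊥ , _)) = ⊥-elim (∉⊥ w∈⊥)

Strong4-∪ : (G : Graph n) {X Y : Subset n} → Strong4 G X → Strong4 G Y → Strong4 G (X ∪ Y)
Strong4-∪ G {X} {Y} sX sY y y∈N[X∪Y] with InClosedN-∪⁻ G X Y y∈N[X∪Y]
... | inj₁ y∈N[X] = Strong4-weaken G sX (p⊆p∪q Y) y y∈N[X]
... | inj₂ y∈N[Y] = Strong4-weaken G sY (q⊆p∪q X Y) y y∈N[Y]

Strong4-⋃ : (G : Graph n) (xs : List (Fin n)) → All (InS G) xs → ∃ λ U → Strong4 G U × All (_∈ U) xs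
Strong4-⋃ G [] [] = ⊥ , Strong4-⊥ G , []
Strong4-⋃ G (x ∷ xs) ((X , sX , x∈X) ∷ xs⊆S) with Strong4-⋃ G xs xs⊆S
... | U , sU , xs⊆U = X ∪ U , Strong4-∪ G sX sU , p⊆p∪q U x∈X ∷ All.map (q⊆p∪q X U) xs⊆U

⊆S⇒⊆Strong4 : (G : Graph n) (A : Subset n) → (∀ x → x ∈ A → InS G x) → ∃ λ U → Strong4 G U × A ⊆ U
⊆S⇒⊆Strong4 {n} G A A⊆S =
  let U , sU , A⊆U = Strong4-⋃ G (filter (_∈? A) (allFin n))
                       (All.tabulate (A⊆S _ ∘ proj₂ ∘ ∈-filter⁻ (_∈? A) {xs = allFin n}))
  in U , sU , λ x∈A → All.lookup A⊆U (∈-filter⁺ (_∈? A) (∈-allFin _) x∈A)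

module Transfer (G₁ G₂ : Graph n) (A B : Subset n)
  (N[B]⊆A : ∀ y → InN G₁ B y ⊎ InN G₂ B y → y ∈ A)
  (Δ⊆A∪B : ∀ x y → adj G₁ x y ≢ adj G₂ x y → (x ∈ A ⊎ x ∈ B) × (y ∈ A ⊎ y ∈ B))
  where

  adj-agree : {y : Fin n} → y ∉ A → y ∉ B → ∀ w → adj G₁ y w ≡ adj G₂ y w
  adj-agree {y} y∉A y∉B w with adj G₁ y w Bool.≟ adj G₂ y w
  ... | yes same = same
  ... | no differ = [ ⊥-elim ∘ y∉A , ⊥-elim ∘ y∉B ] (proj₁ (Δ⊆A∪B y w differ))

  -- Otherwise the neighbour of y in X ∖ B would lie in N(B) ⊆ A ⊆ U.
  ∉B-outside-N[U] : {X U : Subset n} {y : Fin n} → A ⊆ U →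
                    InClosedN G₂ (X ∩ ∁ B) y → ¬ InClosedN G₂ U y → y ∉ B
  ∉B-outside-N[U] {X} A⊆U (inj₁ y∈X∖B) _ = x∈p∩∁q⇒x∉q X y∈X∖B
  ∉B-outside-N[U] {X} {U} {y} A⊆U (inj₂ (_ , w , w∈X∖B , e)) y∉N[U] y∈B =
    y∉N[U] (inj₂ (y∉N[U] ∘ inj₁ , w , w∈U , e))
    where
    w∈U : w ∈ U
    w∈U = A⊆U (N[B]⊆A w (inj₂ (x∈p∩∁q⇒x∉q X w∈X∖B , y , y∈B , Adj-sym G₂ e)))

  Strong4-transfer : {X U : Subset n} → A ⊆ U → Strong4 G₁ X → Strong4 G₂ U → Strong4 G₂ ((X ∩ ∁ B) ∪ U)
  Strong4-transfer {X} {U} A⊆U sX sU y y∈N[Y] with inClosedN? G₂ U y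
  ... | yes y∈N[U] = Strong4-weaken G₂ sU (q⊆p∪q (X ∩ ∁ B) U) y y∈N[U]
  ... | no y∉N[U] = ≤-trans (sX y y∈N₁[X]) (p⊆q⇒∣p∣≤∣q∣ N₁[y]∩X⊆N₂[y]∩Y)
    where
    y∈N[X∖B] : InClosedN G₂ (X ∩ ∁ B) y
    y∈N[X∖B] = [ id , ⊥-elim ∘ y∉N[U] ] (InClosedN-∪⁻ G₂ (X ∩ ∁ B) U y∈N[Y])
    y∉A : y ∉ A
    y∉A = y∉N[U] ∘ inj₁ ∘ A⊆U
    y∉B : y ∉ B
    y∉B = ∉B-outside-N[U] A⊆U y∈N[X∖B] y∉N[U]
    agree : ∀ w → adj G₁ y w ≡ adj G₂ y w
    agree = adj-agree y∉A y∉B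
    y∈N₁[X] : InClosedN G₁ X y
    y∈N₁[X] = InClosedN-agree G₁ G₂ agree (InClosedN-mono G₂ (p∩q⊆p X (∁ B)) y∈N[X∖B])
    N₁[y]∩X⊆N₂[y]∩Y : nbhd G₁ y ∩ X ⊆ nbhd G₂ y ∩ ((X ∩ ∁ B) ∪ U)
    N₁[y]∩X⊆N₂[y]∩Y {w} w∈ =
      x∈p∩q⁺ (subst (w ∈_) (nbhd-cong G₁ G₂ agree) w∈N₁[y] , p⊆p∪q U (x∈p∩q⁺ (w∈X , x∉p⇒x∈∁p w∉B)))
      where
      w∈N₁[y] : w ∈ nbhd G₁ y
      w∈N₁[y] = proj₁ (x∈p∩q⁻ (nbhd G₁ y) X w∈)
      w∈X : w ∈ X
      w∈X = proj₂ (x∈p∩q⁻ (nbhd G₁ y) X w∈)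
      w∉B : w ∉ B
      w∉B w∈B = y∉A (N[B]⊆A y (inj₁ (y∉B , w , w∈B , Adj-sym G₁ (∈nbhd⇒Adj G₁ w∈N₁[y]))))

lemma4p4 : ∀ {n} (G₁ G₂ : Graph n) (A B : Subset n)
    → (∀ x → x ∈ A → InS G₂ x)
    → (∀ y → InN G₁ B y ⊎ InN G₂ B y → y ∈ A)
    → (∀ x y → adj G₁ x y ≢ adj G₂ x y → (x ∈ A ⊎ x ∈ B) × (y ∈ A ⊎ y ∈ B))
    → ∀ x → InS G₁ x → x ∉ B → InS G₂ x × x ∉ B
lemma4p4 G₁ G₂ A B A⊆S₂ N[B]⊆A Δ⊆A∪B x (X , sX , x∈X) x∉B =
  let U , sU , A⊆U = ⊆S⇒⊆Strong4 G₂ A A⊆S₂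
      open Transfer G₁ G₂ A B N[B]⊆A Δ⊆A∪B
  in ((X ∩ ∁ B) ∪ U , Strong4-transfer A⊆U sX sU , p⊆p∪q U (x∈p∩q⁺ (x∈X , x∉p⇒x∈∁p x∉B))) , x∉B
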